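{- $A_4(0)=1$, $A_4(1)=7$, $A_4(2n+1)=7A_4(n)+A_4(n-1)$ for all $n\ge 1$, and $A_4(2n+2)=7A_4(n)+A_4(n+1)$ for all $n\ge 1$.
   Context: A P-position of the game of Nim with $k$ piles is a $k$-tuple $(p_1,\dots,p_k)$ of non-negative integers whose nim-sum $p_1\oplus\cdots\oplus p_k$ is $0$, where $\oplus$ denotes bitwise XOR. $A_k(n)$ denotes the number of P-positions with $k$ piles whose total number of counters is at most $2n$. -}

module Defs where

open import Data.Nat using (ℕ; zero; suc; _+_; _*_; _≤?_; _≟_)
open import Data.Nat.DivMod using (_/_; _%_)
open import Data.Bool using (Bool; true; false; if_then_else_)
open import Data.List using (List; []; _∷_; length; filter; concatMap; map; upTo)
open import Data.Vec using (Vec; []; _∷_; foldr)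
open import Relation.Nullary.Decidable using (_×-dec_)

-- Bitwise XOR on natural numbers (nim-sum).  The fuel argument only
-- ensures structural recursion; with fuel ≥ a + b the result is the
-- usual bitwise XOR, since each step halves both arguments.
xorFuel : ℕ → ℕ → ℕ → ℕ
xorFuel zero    a b = 0
xorFuel (suc f) a b =
  (if (a % 2) Data.Nat.≡ᵇ (b % 2) then 0 else 1) + 2 * xorFuel f (a / 2) (b / 2)

_⊕_ : ℕ → ℕ → ℕ
a ⊕ b = xorFuel (a + b) a b

infixl 6 _⊕_

nimSum : ∀ {k} → Vec ℕ k → ℕ
nimSum = foldr _ _⊕_ 0

total : ∀ {k} → Vec ℕ k → ℕ
total = foldr _ _+_ 0

tuples : (k m : ℕ) → List (Vec ℕ k)
tuples zero    m = [] ∷ []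
tuples (suc k) m = concatMap (λ x → map (x ∷_) (tuples k m)) (upTo (suc m))

-- A k n = number of P-positions (nim-sum 0) with k piles and total ≤ 2n.
-- Every such tuple has all entries ≤ 2n, so enumerating entries in
-- {0,…,2n} is exhaustive.
A : ℕ → ℕ → ℕ
A k n = length (filter (λ p → (total p ≤? 2 * n) ×-dec (nimSum p ≟ 0)) (tuples k (2 * n)))

module Submission where

open import Defs
open import Data.Nat using (ℕ; zero; suc; _+_; _*_; _≤_; _<_; _≤?_; _≟_; _≡ᵇ_; z≤n; s≤s; _≤′_; ≤′-refl; ≤′-step)
open import Data.Nat.Properties
open import Data.Nat.DivMod using (_/_; _%_; m*[n/m]≡n; m*n/n≡m; m/n≤m; m/n<m; %-remove-+ʳ; %-distribˡ-+; m%n%n≡m%n; m%n<n; +-distrib-/-∣ʳ)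
open import Data.Nat.Divisibility using (m∣m*n; m%n≡0⇒n∣m)
open import Data.Nat.Tactic.RingSolver using (solve-∀)
open import Algebra.Properties.CommutativeSemigroup +-commutativeSemigroup using (interchange)
open import Data.Bool using (Bool; true; false; if_then_else_)
open import Data.Bool.Properties using (∧-zeroʳ; ¬-not)
open import Data.Vec using (Vec; []; _∷_; zipWith)
open import Data.List using ([]; _∷_; _++_; length; filter; map; concatMap; applyUpTo)
open import Data.List.Properties using (length-++; filter-++)
open import Data.Product using (_×_; _,_; proj₁)
open import Data.Product.Function.NonDependent.Propositional using (_×-⇔_)
open import Data.Empty using (⊥-elim)
open import Function using (_∘_; id; _⇔_; mk⇔)
open import Relation.Nullary using (Dec; does; yes; no)
open import Relation.Nullary.Decidable using (_×-dec_; does-⇔)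
open import Relation.Unary using (Pred; Decidable)
open import Relation.Binary.PropositionalEquality

-- Writing every pile as p = b + 2q with b ∈ {0,1}, the nim-sum splits as
-- nimSum b + 2 nimSum q, so p is a P-position iff b has an even number of
-- ones and q is a P-position; its total is |b| + 2 total q.  Hence the
-- number C(M) of P-positions with total ≤ M is the sum of C(⌊(M − |b|)/2⌋)
-- over the 0/1-vectors b of even weight |b| ≤ M.  For four piles (one b of
-- weight 0, six of weight 2, one of weight 4) this reads
-- C(2N) = C(N) + 6 C(N − 1) + C(N − 2), and since P-positions have even
-- total, C(2m) = C(2m + 1) = A(m).

-- Bitwise XOR

lowBitXor : ℕ → ℕ → ℕ
lowBitXor x y = if x ≡ᵇ y then 0 else 1

xorFuel-0-0 : ∀ f → xorFuel f 0 0 ≡ 0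
xorFuel-0-0 zero    = refl
xorFuel-0-0 (suc f) = cong (2 *_) (xorFuel-0-0 f)

halves-< : ∀ a b → a + b ≢ 0 → a / 2 + b / 2 < a + b
halves-< zero    zero    a+b≢0 = ⊥-elim (a+b≢0 refl)
halves-< zero    (suc b) _     = m/n<m (suc b) 2 (s≤s (s≤s z≤n))
halves-< (suc a) b       _     = +-mono-<-≤ (m/n<m (suc a) 2 (s≤s (s≤s z≤n))) (m/n≤m b 2)

xorFuel-irrelevant : ∀ f g a b → a + b ≤ f → a + b ≤ g → xorFuel f a b ≡ xorFuel g a b
xorFuel-irrelevant zero    g       zero    zero    _  _  = sym (xorFuel-0-0 g)
xorFuel-irrelevant (suc f) zero    zero    zero    _  _  = xorFuel-0-0 (suc f)
xorFuel-irrelevant (suc f) (suc g) a       b       ≤f ≤g with a + b ≟ 0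
... | yes a+b≡0 rewrite m+n≡0⇒m≡0 a a+b≡0 | m+n≡0⇒n≡0 a a+b≡0 =
  trans (xorFuel-0-0 (suc f)) (sym (xorFuel-0-0 (suc g)))
... | no a+b≢0 = cong (λ z → lowBitXor (a % 2) (b % 2) + 2 * z)
  (xorFuel-irrelevant f g (a / 2) (b / 2) (shrink ≤f) (shrink ≤g))
  where
  shrink : ∀ {h} → a + b ≤ suc h → a / 2 + b / 2 ≤ h
  shrink ≤h = ≤-pred (≤-trans (halves-< a b a+b≢0) ≤h)
xorFuel-irrelevant zero    _       (suc _) _       () _
xorFuel-irrelevant zero    _       zero    (suc _) () _
xorFuel-irrelevant (suc _) zero    (suc _) _       _  ()
xorFuel-irrelevant (suc _) zero    zero    (suc _) _  ()

⊕-step : ∀ a b → a ⊕ b ≡ lowBitXor (a % 2) (b % 2) + 2 * (a / 2 ⊕ b / 2)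
⊕-step a b = begin
  xorFuel (a + b) a b
    ≡⟨ xorFuel-irrelevant (a + b) (suc (a + b)) a b ≤-refl (n≤1+n _) ⟩
  lowBitXor (a % 2) (b % 2) + 2 * xorFuel (a + b) (a / 2) (b / 2)
    ≡⟨ cong (λ z → lowBitXor (a % 2) (b % 2) + 2 * z)
            (xorFuel-irrelevant (a + b) (a / 2 + b / 2) (a / 2) (b / 2) halves≤ ≤-refl) ⟩
  lowBitXor (a % 2) (b % 2) + 2 * (a / 2 ⊕ b / 2) ∎
  where
  open ≡-Reasoning
  halves≤ : a / 2 + b / 2 ≤ a + b
  halves≤ = +-mono-≤ (m/n≤m a 2) (m/n≤m b 2)

data Bit : ℕ → Set where
  bit0 : Bit 0
  bit1 : Bit 1

Bit-%2 : ∀ a → Bit (a % 2)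
Bit-%2 a with a % 2 | m%n<n a 2
... | 0           | _                = bit0
... | 1           | _                = bit1
... | suc (suc _) | s≤s (s≤s ())

Bit-⊕ : ∀ {x y} → Bit x → Bit y → Bit (x ⊕ y)
Bit-⊕ bit0 bit0 = bit0
Bit-⊕ bit0 bit1 = bit1
Bit-⊕ bit1 bit0 = bit1
Bit-⊕ bit1 bit1 = bit0

lowBitXor-Bit : ∀ {x y} → Bit x → Bit y → lowBitXor x y ≡ x ⊕ y
lowBitXor-Bit bit0 bit0 = refl
lowBitXor-Bit bit0 bit1 = refl
lowBitXor-Bit bit1 bit0 = refl
lowBitXor-Bit bit1 bit1 = refl

lowBitXor-sum : ∀ {x y} → Bit x → Bit y → lowBitXor x y ≡ (x + y) % 2
lowBitXor-sum bit0 bit0 = refl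
lowBitXor-sum bit0 bit1 = refl
lowBitXor-sum bit1 bit0 = refl
lowBitXor-sum bit1 bit1 = refl

[x+2y]%2≡x : ∀ {x} y → Bit x → (x + 2 * y) % 2 ≡ x
[x+2y]%2≡x y bit0 = %-remove-+ʳ 0 {2 * y} {2} (m∣m*n y)
[x+2y]%2≡x y bit1 = %-remove-+ʳ 1 {2 * y} {2} (m∣m*n y)

[x+2y]/2≡y : ∀ {x} y → Bit x → (x + 2 * y) / 2 ≡ y
[x+2y]/2≡y y bit0 = trans (cong (_/ 2) (*-comm 2 y)) (m*n/n≡m y 2)
[x+2y]/2≡y y bit1 = trans (+-distrib-/-∣ʳ 1 {2 * y} {2} (m∣m*n y)) ([x+2y]/2≡y y bit0)

⊕-binary : ∀ {x x′} y y′ → Bit x → Bit x′ → (x + 2 * y) ⊕ (x′ + 2 * y′) ≡ (x ⊕ x′) + 2 * (y ⊕ y′)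
⊕-binary {x} {x′} y y′ bx bx′ = begin
  (x + 2 * y) ⊕ (x′ + 2 * y′)
    ≡⟨ ⊕-step (x + 2 * y) (x′ + 2 * y′) ⟩
  lowBitXor ((x + 2 * y) % 2) ((x′ + 2 * y′) % 2) + 2 * ((x + 2 * y) / 2 ⊕ (x′ + 2 * y′) / 2)
    ≡⟨ cong₂ _+_ (cong₂ lowBitXor ([x+2y]%2≡x y bx) ([x+2y]%2≡x y′ bx′))
                 (cong (2 *_) (cong₂ _⊕_ ([x+2y]/2≡y y bx) ([x+2y]/2≡y y′ bx′))) ⟩
  lowBitXor x x′ + 2 * (y ⊕ y′)
    ≡⟨ cong (_+ 2 * (y ⊕ y′)) (lowBitXor-Bit bx bx′) ⟩
  (x ⊕ x′) + 2 * (y ⊕ y′) ∎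
  where open ≡-Reasoning

⊕-parity : ∀ a b → (a ⊕ b) % 2 ≡ (a + b) % 2
⊕-parity a b = begin
  (a ⊕ b) % 2                                   ≡⟨ cong (_% 2) (⊕-step a b) ⟩
  (lowBitXor (a % 2) (b % 2) + 2 * (a / 2 ⊕ b / 2)) % 2
    ≡⟨ %-remove-+ʳ (lowBitXor (a % 2) (b % 2)) {d = 2} (m∣m*n (a / 2 ⊕ b / 2)) ⟩
  lowBitXor (a % 2) (b % 2) % 2                 ≡⟨ cong (_% 2) (lowBitXor-sum (Bit-%2 a) (Bit-%2 b)) ⟩
  (a % 2 + b % 2) % 2 % 2                       ≡⟨ m%n%n≡m%n (a % 2 + b % 2) 2 ⟩
  (a % 2 + b % 2) % 2                           ≡⟨ sym (%-distribˡ-+ a b 2) ⟩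
  (a + b) % 2                                   ∎
  where open ≡-Reasoning

nimSum-parity : ∀ {k} (p : Vec ℕ k) → nimSum p % 2 ≡ total p % 2
nimSum-parity []      = refl
nimSum-parity (x ∷ p) = begin
  (x ⊕ nimSum p) % 2             ≡⟨ ⊕-parity x (nimSum p) ⟩
  (x + nimSum p) % 2             ≡⟨ %-distribˡ-+ x (nimSum p) 2 ⟩
  (x % 2 + nimSum p % 2) % 2     ≡⟨ cong (λ z → (x % 2 + z) % 2) (nimSum-parity p) ⟩
  (x % 2 + total p % 2) % 2      ≡⟨ sym (%-distribˡ-+ x (total p) 2) ⟩
  (x + total p) % 2              ∎
  where open ≡-Reasoning

-- Binary splitting of positions

data Bits : ∀ {k} → Vec ℕ k → Set where
  []  : Bits []
  _∷_ : ∀ {k x} {b : Vec ℕ k} → Bit x → Bits b → Bits (x ∷ b)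

_+2*_ : ∀ {k} → Vec ℕ k → Vec ℕ k → Vec ℕ k
_+2*_ = zipWith (λ x y → x + 2 * y)

total-+2* : ∀ {k} (b q : Vec ℕ k) → total (b +2* q) ≡ total b + 2 * total q
total-+2* []      []      = refl
total-+2* (x ∷ b) (y ∷ q) = begin
  x + 2 * y + total (b +2* q)          ≡⟨ cong (x + 2 * y +_) (total-+2* b q) ⟩
  x + 2 * y + (total b + 2 * total q)  ≡⟨ regroup x y (total b) (total q) ⟩
  x + total b + 2 * (y + total q)      ∎
  where
  open ≡-Reasoning
  regroup : ∀ x y t u → x + 2 * y + (t + 2 * u) ≡ x + t + 2 * (y + u)
  regroup = solve-∀

Bit-nimSum : ∀ {k} {b : Vec ℕ k} → Bits b → Bit (nimSum b)
Bit-nimSum []        = bit0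
Bit-nimSum (bx ∷ bs) = Bit-⊕ bx (Bit-nimSum bs)

nimSum-+2* : ∀ {k} {b : Vec ℕ k} → Bits b → (q : Vec ℕ k) → nimSum (b +2* q) ≡ nimSum b + 2 * nimSum q
nimSum-+2* []                    []      = refl
nimSum-+2* {b = x ∷ b} (bx ∷ bs) (y ∷ q) = begin
  (x + 2 * y) ⊕ nimSum (b +2* q)           ≡⟨ cong ((x + 2 * y) ⊕_) (nimSum-+2* bs q) ⟩
  (x + 2 * y) ⊕ (nimSum b + 2 * nimSum q)  ≡⟨ ⊕-binary y (nimSum q) bx (Bit-nimSum bs) ⟩
  (x ⊕ nimSum b) + 2 * (y ⊕ nimSum q)      ∎
  where open ≡-Reasoning

-- Finite sums

∑< : ℕ → (ℕ → ℕ) → ℕ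
∑< zero    f = 0
∑< (suc n) f = f 0 + ∑< n (f ∘ suc)

syntax ∑< n (λ x → e) = ∑[ x < n ] e

∑-cong : ∀ n {f g : ℕ → ℕ} → (∀ x → f x ≡ g x) → ∑< n f ≡ ∑< n g
∑-cong zero    f≗g = refl
∑-cong (suc n) f≗g = cong₂ _+_ (f≗g 0) (∑-cong n (f≗g ∘ suc))

∑-zero : ∀ n {f : ℕ → ℕ} → (∀ x → f x ≡ 0) → ∑< n f ≡ 0
∑-zero zero    f≗0 = refl
∑-zero (suc n) f≗0 = cong₂ _+_ (f≗0 0) (∑-zero n (f≗0 ∘ suc))

∑-distrib-+ : ∀ n (f g : ℕ → ℕ) → ∑[ x < n ] (f x + g x) ≡ ∑< n f + ∑< n g
∑-distrib-+ zero    f g = refl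
∑-distrib-+ (suc n) f g = trans (cong (f 0 + g 0 +_) (∑-distrib-+ n (f ∘ suc) (g ∘ suc)))
                                (interchange (f 0) (g 0) (∑< n (f ∘ suc)) (∑< n (g ∘ suc)))

∑-snoc : ∀ n (f : ℕ → ℕ) → ∑< (suc n) f ≡ ∑< n f + f n
∑-snoc zero    f = +-comm (f 0) 0
∑-snoc (suc n) f = trans (cong (f 0 +_) (∑-snoc n (f ∘ suc))) (sym (+-assoc (f 0) _ _))

∑-evens-odds : ∀ n (f : ℕ → ℕ) → ∑< (2 * n) f ≡ ∑[ y < n ] (f (2 * y) + f (1 + 2 * y))
∑-evens-odds zero    f = refl
∑-evens-odds (suc n) f = begin
  ∑< (2 * suc n) f
    ≡⟨ cong (λ l → ∑< l f) (*-suc 2 n) ⟩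
  f 0 + (f 1 + ∑< (2 * n) (f ∘ suc ∘ suc))
    ≡⟨ sym (+-assoc (f 0) (f 1) _) ⟩
  f 0 + f 1 + ∑< (2 * n) (f ∘ suc ∘ suc)
    ≡⟨ cong (f 0 + f 1 +_) (∑-evens-odds n (f ∘ suc ∘ suc)) ⟩
  f 0 + f 1 + ∑[ y < n ] (f (2 + 2 * y) + f (3 + 2 * y))
    ≡⟨ cong (f 0 + f 1 +_) (∑-cong n λ y → cong₂ _+_ (cong f (sym (*-suc 2 y)))
                                                      (cong (f ∘ suc) (sym (*-suc 2 y)))) ⟩
  ∑[ y < suc n ] (f (2 * y) + f (1 + 2 * y)) ∎
  where open ≡-Reasoning

∑bits : (k : ℕ) → (Vec ℕ k → ℕ) → ℕ
∑bits zero    f = f []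
∑bits (suc k) f = ∑bits k (f ∘ (0 ∷_)) + ∑bits k (f ∘ (1 ∷_))

∑bits-cong : ∀ k {f g : Vec ℕ k → ℕ} → (∀ {b} → Bits b → f b ≡ g b) → ∑bits k f ≡ ∑bits k g
∑bits-cong zero    f≗g = f≗g []
∑bits-cong (suc k) f≗g = cong₂ _+_ (∑bits-cong k (f≗g ∘ (bit0 ∷_))) (∑bits-cong k (f≗g ∘ (bit1 ∷_)))

∑bits-zero : ∀ k → ∑bits k (λ _ → 0) ≡ 0
∑bits-zero zero    = refl
∑bits-zero (suc k) = cong₂ _+_ (∑bits-zero k) (∑bits-zero k)

∑bits-distrib-+ : ∀ k (f g : Vec ℕ k → ℕ) → ∑bits k (λ b → f b + g b) ≡ ∑bits k f + ∑bits k g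
∑bits-distrib-+ zero    f g = refl
∑bits-distrib-+ (suc k) f g =
  trans (cong₂ _+_ (∑bits-distrib-+ k (f ∘ (0 ∷_)) (g ∘ (0 ∷_))) (∑bits-distrib-+ k (f ∘ (1 ∷_)) (g ∘ (1 ∷_))))
        (interchange (∑bits k (f ∘ (0 ∷_))) (∑bits k (g ∘ (0 ∷_))) (∑bits k (f ∘ (1 ∷_))) (∑bits k (g ∘ (1 ∷_))))

∑-∑bits-comm : ∀ k n (F : ℕ → Vec ℕ k → ℕ) → ∑[ y < n ] ∑bits k (F y) ≡ ∑bits k (λ b → ∑[ y < n ] F y b)
∑-∑bits-comm k zero    F = sym (∑bits-zero k)
∑-∑bits-comm k (suc n) F = trans (cong (∑bits k (F 0) +_) (∑-∑bits-comm k n (F ∘ suc)))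
                                 (sym (∑bits-distrib-+ k (F 0) (λ b → ∑[ y < n ] F (suc y) b)))

-- Counting tuples in a box

count : (k m : ℕ) → (Vec ℕ k → Bool) → ℕ
count zero    m P = if P [] then 1 else 0
count (suc k) m P = ∑[ x < suc m ] count k m (λ v → P (x ∷ v))

count-cong : ∀ k m {P Q : Vec ℕ k → Bool} → (∀ v → P v ≡ Q v) → count k m P ≡ count k m Q
count-cong zero    m P≗Q = cong (λ b → if b then 1 else 0) (P≗Q [])
count-cong (suc k) m P≗Q = ∑-cong (suc m) λ x → count-cong k m (P≗Q ∘ (x ∷_))

count-never : ∀ k m {P : Vec ℕ k → Bool} → (∀ v → P v ≡ false) → count k m P ≡ 0
count-never zero    m P≗false = cong (λ b → if b then 1 else 0) (P≗false [])
count-never (suc k) m P≗false = ∑-zero (suc m) λ x → count-never k m (P≗false ∘ (x ∷_))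

module _ {a b p} {A : Set a} {B : Set b} {P : Pred B p} (P? : Decidable P) where

  length-filter-map : ∀ (f : A → B) xs → length (filter P? (map f xs)) ≡ length (filter (P? ∘ f) xs)
  length-filter-map f []       = refl
  length-filter-map f (x ∷ xs) with does (P? (f x))
  ... | true  = cong suc (length-filter-map f xs)
  ... | false = length-filter-map f xs

length-filter-tuples : ∀ {p} k m {P : Pred (Vec ℕ k) p} (P? : Decidable P) →
                       length (filter P? (tuples k m)) ≡ count k m (does ∘ P?)
length-filter-tuples zero    m P? with does (P? [])
... | true  = refl
... | false = refl
length-filter-tuples (suc k) m P? = prefix (suc m) id
  where
  prefix : ∀ n f → length (filter P? (concatMap (λ x → map (x ∷_) (tuples k m)) (applyUpTo f n)))
                 ≡ ∑[ x < n ] count k m (λ v → does (P? (f x ∷ v)))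
  prefix zero    f = refl
  prefix (suc n) f = begin
    length (filter P? (map (f 0 ∷_) (tuples k m) ++ rest))
      ≡⟨ cong length (filter-++ P? (map (f 0 ∷_) (tuples k m)) rest) ⟩
    length (filter P? (map (f 0 ∷_) (tuples k m)) ++ filter P? rest)
      ≡⟨ length-++ (filter P? (map (f 0 ∷_) (tuples k m))) ⟩
    length (filter P? (map (f 0 ∷_) (tuples k m))) + length (filter P? rest)
      ≡⟨ cong₂ _+_ (trans (length-filter-map P? (f 0 ∷_) (tuples k m))
                          (length-filter-tuples k m (P? ∘ (f 0 ∷_))))
                   (prefix n (f ∘ suc)) ⟩
    count k m (λ v → does (P? (f 0 ∷ v))) + ∑[ x < n ] count k m (λ v → does (P? (f (suc x) ∷ v))) ∎
    where
    open ≡-Reasoning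
    rest = concatMap (λ x → map (x ∷_) (tuples k m)) (applyUpTo (f ∘ suc) n)

BoundedBy : ∀ {k} → (Vec ℕ k → Bool) → ℕ → Set
BoundedBy P M = ∀ v → P v ≡ true → total v ≤ M

count-extend : ∀ k M {P : Vec ℕ k → Bool} → BoundedBy P M → count k M P ≡ count k (suc M) P
count-extend zero    M bounded = refl
count-extend (suc k) M {P} bounded = begin
  ∑[ x < suc M ] count k M (λ v → P (x ∷ v))
    ≡⟨ ∑-cong (suc M) (λ x → count-extend k M (tail-bounded x)) ⟩
  ∑< (suc M) column
    ≡⟨ sym (+-identityʳ _) ⟩
  ∑< (suc M) column + 0
    ≡⟨ cong (∑< (suc M) column +_) (sym (count-never k (suc M) (λ v → ¬-not (too-large v)))) ⟩
  ∑< (suc M) column + column (suc M)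
    ≡⟨ sym (∑-snoc (suc M) column) ⟩
  ∑< (suc (suc M)) column ∎
  where
  open ≡-Reasoning
  column : ℕ → ℕ
  column x = count k (suc M) (λ v → P (x ∷ v))
  tail-bounded : ∀ x → BoundedBy (λ v → P (x ∷ v)) M
  tail-bounded x v Pxv = ≤-trans (m≤n+m (total v) x) (bounded (x ∷ v) Pxv)
  too-large : ∀ v → P (suc M ∷ v) ≢ true
  too-large v Pv = <-irrefl refl (≤-trans (m≤m+n (suc M) (total v)) (bounded (suc M ∷ v) Pv))

count-box : ∀ k {M m} {P : Vec ℕ k → Bool} → BoundedBy P M → M ≤ m → count k M P ≡ count k m P
count-box k {M} {P = P} bounded M≤m = go (≤⇒≤′ M≤m)
  where
  go : ∀ {m} → M ≤′ m → count k M P ≡ count k m P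
  go ≤′-refl        = refl
  go (≤′-step M≤′m) = trans (go M≤′m) (count-extend k _ (λ v Pv → ≤-trans (bounded v Pv) (≤′⇒≤ M≤′m)))

count-binary-split : ∀ k M (P : Vec ℕ k → Bool) →
                     count k (suc (2 * M)) P ≡ ∑bits k (λ b → count k M (λ q → P (b +2* q)))
count-binary-split zero    M P = refl
count-binary-split (suc k) M P = begin
  ∑< (2 + 2 * M) column
    ≡⟨ cong (λ l → ∑< l column) (sym (*-suc 2 M)) ⟩
  ∑< (2 * suc M) column
    ≡⟨ ∑-evens-odds (suc M) column ⟩
  ∑[ y < suc M ] (column (2 * y) + column (1 + 2 * y))
    ≡⟨ ∑-cong (suc M) (λ y → cong₂ _+_ (count-binary-split k M (λ v → P (2 * y ∷ v)))
                                       (count-binary-split k M (λ v → P (1 + 2 * y ∷ v)))) ⟩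
  ∑[ y < suc M ] (∑bits k (F 0 y) + ∑bits k (F 1 y))
    ≡⟨ ∑-distrib-+ (suc M) (∑bits k ∘ F 0) (∑bits k ∘ F 1) ⟩
  ∑[ y < suc M ] ∑bits k (F 0 y) + ∑[ y < suc M ] ∑bits k (F 1 y)
    ≡⟨ cong₂ _+_ (∑-∑bits-comm k (suc M) (F 0)) (∑-∑bits-comm k (suc M) (F 1)) ⟩
  ∑bits (suc k) (λ b → count (suc k) M (λ q → P (b +2* q))) ∎
  where
  open ≡-Reasoning
  column : ℕ → ℕ
  column x = count k (suc (2 * M)) (λ v → P (x ∷ v))
  F : ℕ → ℕ → Vec ℕ k → ℕ
  F x y b = count k M (λ q → P (x + 2 * y ∷ b +2* q))

-- Counting P-positions

does≡true⇒ : ∀ {a} {A : Set a} (a? : Dec A) → does a? ≡ true → A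
does≡true⇒ (yes a) _  = a
does≡true⇒ (no _)  ()

PWithin : ℕ → ℕ → ℕ → Bool
PWithin M t s = does ((t ≤? M) ×-dec (s ≟ 0))

PWithin-cong : ∀ {M t s M′ t′ s′} → (t ≤ M × s ≡ 0) ⇔ (t′ ≤ M′ × s′ ≡ 0) → PWithin M t s ≡ PWithin M′ t′ s′
PWithin-cong {M} {t} {s} {M′} {t′} {s′} iff = does-⇔ iff ((t ≤? M) ×-dec (s ≟ 0)) ((t′ ≤? M′) ×-dec (s′ ≟ 0))

isP≤ : ∀ {k} → ℕ → Vec ℕ k → Bool
isP≤ M p = PWithin M (total p) (nimSum p)

countP : ℕ → ℕ → ℕ
countP k M = count k M (isP≤ M)

A≡countP : ∀ k n → A k n ≡ countP k (2 * n)
A≡countP k n = length-filter-tuples k (2 * n) (λ p → (total p ≤? 2 * n) ×-dec (nimSum p ≟ 0))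

isP≤-bounded : ∀ {k} M → BoundedBy {k} (isP≤ M) M
isP≤-bounded M p Pp = proj₁ (does≡true⇒ ((total p ≤? M) ×-dec (nimSum p ≟ 0)) Pp)

countP-binary : ∀ k M → countP k M ≡
  ∑bits k (λ b → count k M (λ q → PWithin M (total b + 2 * total q) (nimSum b + 2 * nimSum q)))
countP-binary k M = begin
  countP k M
    ≡⟨ count-box k (isP≤-bounded M) M≤1+2M ⟩
  count k (suc (2 * M)) (isP≤ M)
    ≡⟨ count-binary-split k M (isP≤ M) ⟩
  ∑bits k (λ b → count k M (λ q → isP≤ M (b +2* q)))
    ≡⟨ ∑bits-cong k (λ {b} bs → count-cong k M λ q → cong₂ (PWithin M) (total-+2* b q) (nimSum-+2* bs q)) ⟩
  ∑bits k (λ b → count k M (λ q → PWithin M (total b + 2 * total q) (nimSum b + 2 * nimSum q))) ∎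
  where
  open ≡-Reasoning
  M≤1+2M : M ≤ suc (2 * M)
  M≤1+2M = ≤-trans (m≤m+n M (M + 0)) (n≤1+n _)

half-≤ : ∀ t m {r} → 2 * t ≤ 2 * m + r → r < 2 → t ≤ m
half-≤ t m {r} 2t≤2m+r r<2 = ≤-pred (*-cancelˡ-< 2 t (suc m) (begin-strict
  2 * t      ≤⟨ 2t≤2m+r ⟩
  2 * m + r  <⟨ +-monoʳ-< (2 * m) r<2 ⟩
  2 * m + 2  ≡⟨ +-comm (2 * m) 2 ⟩
  2 + 2 * m  ≡⟨ sym (*-suc 2 m) ⟩
  2 * suc m  ∎))
  where open ≤-Reasoning

PWithin-halve : ∀ {M} w {m r} → M ≡ w + (2 * m + r) → r < 2 →
                ∀ t s → PWithin M (w + 2 * t) (2 * s) ≡ PWithin m t s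
PWithin-halve w {m} {r} refl r<2 t s = PWithin-cong (total-bound ×-⇔ nim-zero)
  where
  total-bound : w + 2 * t ≤ w + (2 * m + r) ⇔ t ≤ m
  total-bound = mk⇔ (λ le → half-≤ t m (+-cancelˡ-≤ w (2 * t) (2 * m + r) le) r<2)
                    (λ t≤m → +-monoʳ-≤ w (≤-trans (*-monoʳ-≤ 2 t≤m) (m≤m+n (2 * m) r)))
  nim-zero : 2 * s ≡ 0 ⇔ s ≡ 0
  nim-zero = mk⇔ (m+n≡0⇒m≡0 s) (cong (2 *_))

count-halve : ∀ k {M} w m {r} → M ≡ w + (2 * m + r) → r < 2 →
              count k M (λ q → PWithin M (w + 2 * total q) (2 * nimSum q)) ≡ countP k m
count-halve k {M} w m {r} M≡ r<2 = begin
  count k M (λ q → PWithin M (w + 2 * total q) (2 * nimSum q))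
    ≡⟨ count-cong k M (λ q → PWithin-halve w M≡ r<2 (total q) (nimSum q)) ⟩
  count k M (isP≤ m)
    ≡⟨ sym (count-box k (isP≤-bounded m) m≤M) ⟩
  countP k m ∎
  where
  open ≡-Reasoning
  m≤M : m ≤ M
  m≤M = subst (m ≤_) (sym M≡) (≤-trans (≤-trans (m≤m+n m (m + 0)) (m≤m+n (2 * m) r)) (m≤n+m _ w))

even-≤ : ∀ t m {r} → t % 2 ≡ 0 → t ≤ 2 * m + r → r < 2 → t ≤ 2 * m
even-≤ t m {r} t%2≡0 t≤2m+r r<2 =
  subst (_≤ 2 * m) 2[t/2]≡t (*-monoʳ-≤ 2 (half-≤ (t / 2) m (subst (_≤ 2 * m + r) (sym 2[t/2]≡t) t≤2m+r) r<2))
  where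
  2[t/2]≡t : 2 * (t / 2) ≡ t
  2[t/2]≡t = m*[n/m]≡n (m%n≡0⇒n∣m t 2 t%2≡0)

countP-drop-odd : ∀ k m {r} → r < 2 → countP k (2 * m + r) ≡ countP k (2 * m)
countP-drop-odd k m {r} r<2 = begin
  countP k (2 * m + r)
    ≡⟨ count-cong k (2 * m + r) (λ p → PWithin-cong (even-total p)) ⟩
  count k (2 * m + r) (isP≤ (2 * m))
    ≡⟨ sym (count-box k (isP≤-bounded (2 * m)) (m≤m+n (2 * m) r)) ⟩
  countP k (2 * m) ∎
  where
  open ≡-Reasoning
  even-total : ∀ p → (total p ≤ 2 * m + r × nimSum p ≡ 0) ⇔ (total p ≤ 2 * m × nimSum p ≡ 0)
  even-total p = mk⇔ (λ (t≤ , s≡0) → even-≤ (total p) m (total-even s≡0) t≤ r<2 , s≡0)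
                     (λ (t≤ , s≡0) → ≤-trans t≤ (m≤m+n (2 * m) r) , s≡0)
    where
    total-even : nimSum p ≡ 0 → total p % 2 ≡ 0
    total-even s≡0 = trans (sym (nimSum-parity p)) (cong (_% 2) s≡0)

countP-half : ∀ k {M} m {r} → M ≡ 2 * m + r → r < 2 → countP k M ≡ A k m
countP-half k {M} m {r} M≡ r<2 = begin
  countP k M           ≡⟨ cong (countP k) M≡ ⟩
  countP k (2 * m + r) ≡⟨ countP-drop-odd k m r<2 ⟩
  countP k (2 * m)     ≡⟨ sym (A≡countP k m) ⟩
  A k m ∎
  where open ≡-Reasoning

-- Four piles

∑bits₄-by-weight : (L : ℕ → ℕ → ℕ) → (∀ w → L w 1 ≡ 0) →
                   ∑bits 4 (λ b → L (total b) (nimSum b)) ≡ L 0 0 + 6 * L 2 0 + L 4 0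
∑bits₄-by-weight L odd-vanishes =
  trans (cong₂ (summands (L 0 0) (L 2 0) (L 4 0)) (odd-vanishes 1) (odd-vanishes 3))
        (collect (L 0 0) (L 2 0) (L 4 0))
  where
  -- the sixteen summands L (total b) (nimSum b), b running over {0,1}⁴ in lexicographic order
  summands : (w₀ w₂ w₄ o₁ o₃ : ℕ) → ℕ
  summands w₀ w₂ w₄ o₁ o₃ = (((w₀ + o₁) + (o₁ + w₂)) + ((o₁ + w₂) + (w₂ + o₃)))
                          + (((o₁ + w₂) + (w₂ + o₃)) + ((w₂ + o₃) + (o₃ + w₄)))
  collect : ∀ w₀ w₂ w₄ → (((w₀ + 0) + (0 + w₂)) + ((0 + w₂) + (w₂ + 0)))
                          + (((0 + w₂) + (w₂ + 0)) + ((w₂ + 0) + (0 + w₄))) ≡ w₀ + 6 * w₂ + w₄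
  collect = solve-∀

countP₄-double : ∀ n → countP 4 (2 * (2 + n)) ≡ countP 4 (2 + n) + 6 * countP 4 (1 + n) + countP 4 n
countP₄-double n = begin
  countP 4 M
    ≡⟨ countP-binary 4 M ⟩
  ∑bits 4 (λ b → L (total b) (nimSum b))
    ≡⟨ ∑bits₄-by-weight L odd-vanishes ⟩
  L 0 0 + 6 * L 2 0 + L 4 0
    ≡⟨ cong₂ _+_ (cong₂ _+_ (count-halve 4 0 (2 + n) M≡0+_ z<2)
                            (cong (6 *_) (count-halve 4 2 (1 + n) M≡2+_ z<2)))
                 (count-halve 4 4 n M≡4+_ z<2) ⟩
  countP 4 (2 + n) + 6 * countP 4 (1 + n) + countP 4 n ∎
  where
  open ≡-Reasoning
  M = 2 * (2 + n)
  L : ℕ → ℕ → ℕ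
  L w s = count 4 M (λ q → PWithin M (w + 2 * total q) (s + 2 * nimSum q))
  odd-vanishes : ∀ w → L w 1 ≡ 0
  odd-vanishes w = count-never 4 M (λ q → ∧-zeroʳ (does (w + 2 * total q ≤? M)))
  z<2 : 0 < 2
  z<2 = s≤s z≤n
  M≡0+_ : M ≡ 0 + (2 * (2 + n) + 0)
  M≡0+_ = sym (+-identityʳ M)
  M≡2+_ : M ≡ 2 + (2 * (1 + n) + 0)
  M≡2+_ = arith₂ n
    where
    arith₂ : ∀ n → 2 * (2 + n) ≡ 2 + (2 * (1 + n) + 0)
    arith₂ = solve-∀
  M≡4+_ : M ≡ 4 + (2 * n + 0)
  M≡4+_ = arith₄ n
    where
    arith₄ : ∀ n → 2 * (2 + n) ≡ 4 + (2 * n + 0)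
    arith₄ = solve-∀

A₄-split : ∀ {N} n → N ≡ 2 + n → A 4 N ≡ countP 4 (2 + n) + 6 * countP 4 (1 + n) + countP 4 n
A₄-split n refl = trans (A≡countP 4 (2 + n)) (countP₄-double n)

A₄-odd : ∀ n → A 4 (2 * suc n + 1) ≡ 7 * A 4 (suc n) + A 4 n
A₄-odd n = begin
  A 4 (2 * suc n + 1)
    ≡⟨ A₄-split (1 + 2 * n) (arith₁ n) ⟩
  countP 4 (3 + 2 * n) + 6 * countP 4 (2 + 2 * n) + countP 4 (1 + 2 * n)
    ≡⟨ cong₂ _+_ (cong₂ _+_ (countP-half 4 (suc n) (arith₂ n) (s≤s (s≤s z≤n)))
                            (cong (6 *_) (countP-half 4 (suc n) (arith₃ n) (s≤s z≤n))))
                 (countP-half 4 n (+-comm 1 (2 * n)) (s≤s (s≤s z≤n))) ⟩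
  A 4 (suc n) + 6 * A 4 (suc n) + A 4 n
    ≡⟨ collect (A 4 (suc n)) (A 4 n) ⟩
  7 * A 4 (suc n) + A 4 n ∎
  where
  open ≡-Reasoning
  arith₁ : ∀ n → 2 * suc n + 1 ≡ 2 + (1 + 2 * n)
  arith₁ = solve-∀
  arith₂ : ∀ n → 3 + 2 * n ≡ 2 * suc n + 1
  arith₂ = solve-∀
  arith₃ : ∀ n → 2 + 2 * n ≡ 2 * suc n + 0
  arith₃ = solve-∀
  collect : ∀ a b → a + 6 * a + b ≡ 7 * a + b
  collect = solve-∀

A₄-even : ∀ n → A 4 (2 * suc n + 2) ≡ 7 * A 4 (suc n) + A 4 (suc (suc n))
A₄-even n = begin
  A 4 (2 * suc n + 2)
    ≡⟨ A₄-split (2 + 2 * n) (arith₁ n) ⟩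
  countP 4 (4 + 2 * n) + 6 * countP 4 (3 + 2 * n) + countP 4 (2 + 2 * n)
    ≡⟨ cong₂ _+_ (cong₂ _+_ (countP-half 4 (suc (suc n)) (arith₂ n) (s≤s z≤n))
                            (cong (6 *_) (countP-half 4 (suc n) (arith₃ n) (s≤s (s≤s z≤n)))))
                 (countP-half 4 (suc n) (arith₄ n) (s≤s z≤n)) ⟩
  A 4 (suc (suc n)) + 6 * A 4 (suc n) + A 4 (suc n)
    ≡⟨ collect (A 4 (suc n)) (A 4 (suc (suc n))) ⟩
  7 * A 4 (suc n) + A 4 (suc (suc n)) ∎
  where
  open ≡-Reasoning
  arith₁ : ∀ n → 2 * suc n + 2 ≡ 2 + (2 + 2 * n)
  arith₁ = solve-∀
  arith₂ : ∀ n → 4 + 2 * n ≡ 2 * suc (suc n) + 0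
  arith₂ = solve-∀
  arith₃ : ∀ n → 3 + 2 * n ≡ 2 * suc n + 1
  arith₃ = solve-∀
  arith₄ : ∀ n → 2 + 2 * n ≡ 2 * suc n + 0
  arith₄ = solve-∀
  collect : ∀ a b → b + 6 * a + a ≡ 7 * a + b
  collect = solve-∀

lemma27 : (A 4 0 ≡ 1) × (A 4 1 ≡ 7)
    × (∀ (n : ℕ) → A 4 (2 * suc n + 1) ≡ 7 * A 4 (suc n) + A 4 n)
    × (∀ (n : ℕ) → A 4 (2 * suc n + 2) ≡ 7 * A 4 (suc n) + A 4 (suc (suc n)))
lemma27 = refl , refl , A₄-odd , A₄-even
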